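{- Let $q$ be a prime power and let $k\geq 1$ be an integer such that $q-1=4k+R$ for some $R\in\{1,2,3,4,5\}$. Then the mixed graph $H_q$ (constructed from $q$, $k$ and a primitive element $\xi$ of $\mathbb{F}_q$ as described in the context) is a $[k,q;5]$-mixed graph, i.e. every vertex has exactly $k$ incoming arcs, $k$ outgoing arcs and $q$ edges, and $H_q$ has girth $5$.
   Context: A mixed graph $G=(V;E\cup A)$ has a vertex set $V$, a set $E$ of (undirected) edges and a set $A$ of arcs (directed), with no parallel edges, no parallel arcs, and no arc parallel to an edge. A cycle is a sequence of distinct vertices $(v_0,\dots,v_{n-1})$ such that for every $i$ (indices mod $n$) either the edge $v_iv_{i+1}$ or the arc $(v_i,v_{i+1})$ is present (arcs may only be traversed in their direction, and no edge is used twice); its length is $n$. The girth is the length of a shortest cycle. A $[z,r;g]$-mixed graph is a mixed graph of girth $g$ in which every vertex has exactly $z$ incoming arcs, $z$ outgoing arcs and $r$ incident edges. Construction of $H_q$. Let $\mathbb{F}_q$ be the field with $q$ elements, $\mathbb{F}_q^*=\mathbb{F}_q\setminus\{0\}$, and $\xi$ a primitive element (generator of the multiplicative group $\mathbb{F}_q^*$). The vertex set consists of: "points" $(x,y)$ with $x\in\mathbb{F}_q^*$, $y\in\mathbb{F}_q$; "lines" $[m,b]$ with $m\in\mathbb{F}_q^*$, $b\in\mathbb{F}_q$; vertices $L_i$ for $i\in\mathbb{F}_q^*$; and vertices $P_i$ for $i\in\mathbb{F}_q^*$. Edges: $(x,y)[m,b]$ whenever $y=mx+b$; $(x,y)L_x$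 for every point $(x,y)$; $[m,b]P_m$ for every line $[m,b]$; there are no other edges. Arcs: for every $i\in\{1,\dots,k\}$, all arcs $((x,y),(x\xi^i,y))$ for $x\in\mathbb{F}_q^*$, $y\in\mathbb{F}_q$; $(L_x,L_{x\xi^i})$ for $x\in\mathbb{F}_q^*$; $([m,b],[m/\xi^i,b])$ for $m\in\mathbb{F}_q^*$, $b\in\mathbb{F}_q$; and $(P_m,P_{m/\xi^i})$ for $m\in\mathbb{F}_q^*$. -}

module Defs where

open import Level using (0ℓ)
open import Data.Nat as ℕ using (ℕ; zero; suc; _≤_; _∸_)
open import Data.Nat.DivMod using (_mod_)
open import Data.Nat.Primality using (Prime)
open import Data.Fin as Fin using (Fin; toℕ)
import Data.Fin.Properties as FinP
open import Data.Bool using (Bool; true; false; _∧_; _∨_; not)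
open import Data.Product using (Σ; ∃; _×_; _,_; proj₁)
open import Data.Empty using (⊥)
open import Data.Unit using (⊤)
open import Data.Sum using (_⊎_; inj₁; inj₂)
open import Function.Bundles using (_↔_; Inverse)
open import Function.Definitions using (Injective)
open import Relation.Nullary using (¬_; Dec; yes; no)
open import Relation.Nullary.Decidable using (⌊_⌋)
open import Relation.Binary.PropositionalEquality using (_≡_; _≢_; refl; cong; sym; trans)
open import Algebra.Structures using (IsCommutativeRing)

record FiniteField (q : ℕ) : Set₁ where
  infixl 7 _*_
  infixl 6 _+_
  field
    Carrier : Set
    _+_ _*_ : Carrier → Carrier → Carrier
    -_      : Carrier → Carrier
    0# 1#   : Carrier
    isCommutativeRing : IsCommutativeRing _≡_ _+_ _*_ -_ 0# 1#
    0≢1     : 0# ≢ 1#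
    inverse : ∀ x → x ≢ 0# → ∃ λ y → x * y ≡ 1#
    card    : Carrier ↔ Fin q

  _≟_ : (x y : Carrier) → Dec (x ≡ y)
  x ≟ y with Inverse.to card x Fin.≟ Inverse.to card y
  ... | yes e = yes (trans (sym (Inverse.strictlyInverseʳ card x))
                      (trans (cong (Inverse.from card) e) (Inverse.strictlyInverseʳ card y)))
  ... | no ne = no (λ e → ne (cong (Inverse.to card) e))

  _^_ : Carrier → ℕ → Carrier
  x ^ zero  = 1#
  x ^ suc n = x * (x ^ n)

  _==_ : Carrier → Carrier → Bool
  x == y = ⌊ x ≟ y ⌋

  -- F_q^* : nonzero elements (proof-irrelevant Boolean tag)
  Nonzero : Set
  Nonzero = Σ Carrier (λ x → (x == 0#) ≡ false)

  IsPrimitive : Carrier → Set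
  IsPrimitive ξ = ξ ≢ 0# × (∀ x → x ≢ 0# → ∃ λ i → ξ ^ i ≡ x)

IsPrimePower : ℕ → Set
IsPrimePower q = ∃ λ p → ∃ λ e → Prime p × q ≡ p ℕ.^ suc e

record MixedGraph : Set₁ where
  field
    V : Set
    E : V → V → Bool
    A : V → V → Bool

next : ∀ {n} → Fin n → Fin n
next {suc m} i = suc (toℕ i) mod suc m

module _ (G : MixedGraph) where
  open MixedGraph G

  -- G is a mixed graph in the sense of the paper: edges are undirected and
  -- loopless, arcs are loopless, and no arc is parallel to an edge
  -- (parallel edges / parallel arcs are impossible in the relational encoding).
  IsMixedGraph : Set
  IsMixedGraph =
    (∀ u v → E u v ≡ E v u) ×
    (∀ v → E v v ≡ false) ×
    (∀ v → A v v ≡ false) ×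
    (∀ u v → E u v ≡ true → A u v ≡ false)

  Step : V → V → Set
  Step u v = (A u v ≡ true) ⊎ (E u v ≡ true)

  IsEdgeStep : ∀ {u v} → Step u v → Set
  IsEdgeStep (inj₁ _) = ⊥
  IsEdgeStep (inj₂ _) = ⊤

  record Cycle (n : ℕ) : Set where
    field
      nonempty : 1 ≤ n
      vs       : Fin n → V
      distinct : Injective _≡_ _≡_ vs
      steps    : ∀ i → Step (vs i) (vs (next i))
      noEdgeTwice : ∀ i j → i ≢ j → IsEdgeStep (steps i) → IsEdgeStep (steps j) →
                    ¬ (vs i ≡ vs (next j) × vs (next i) ≡ vs j)

  HasGirth : ℕ → Set
  HasGirth g = Cycle g × (∀ n → Cycle n → g ≤ n)

  OutDegree InDegree EdgeDegree : V → ℕ → Set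
  OutDegree  v z = Fin z ↔ Σ V (λ w → A v w ≡ true)
  InDegree   v z = Fin z ↔ Σ V (λ w → A w v ≡ true)
  EdgeDegree v r = Fin r ↔ Σ V (λ w → E v w ≡ true)

  IsZRGMixedGraph : ℕ → ℕ → ℕ → Set
  IsZRGMixedGraph z r g =
    IsMixedGraph ×
    (∀ v → InDegree v z × OutDegree v z × EdgeDegree v r) ×
    HasGirth g

module Construction {q : ℕ} (F : FiniteField q) (k : ℕ) (ξ : FiniteField.Carrier F) where
  open FiniteField F

  data Vtx : Set where
    pt   : Nonzero → Carrier → Vtx
    line : Nonzero → Carrier → Vtx
    Lv   : Nonzero → Vtx
    Pv   : Nonzero → Vtx

  anyUpTo : ℕ → (ℕ → Bool) → Bool
  anyUpTo zero    f = false
  anyUpTo (suc n) f = f (suc n) ∨ anyUpTo n f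

  private
    v : Nonzero → Carrier
    v = proj₁

  edge : Vtx → Vtx → Bool
  edge (pt x y)   (line m b) = y == (v m * v x + b)
  edge (line m b) (pt x y)   = y == (v m * v x + b)
  edge (pt x y)   (Lv i)     = v x == v i
  edge (Lv i)     (pt x y)   = v x == v i
  edge (line m b) (Pv i)     = v m == v i
  edge (Pv i)     (line m b) = v m == v i
  edge _          _          = false

  arc : Vtx → Vtx → Bool
  arc (pt x y) (pt x' y') =
    anyUpTo k (λ i → v x' == (v x * ξ ^ i)) ∧ (y' == y)
  arc (Lv x) (Lv x') = anyUpTo k (λ i → v x' == (v x * ξ ^ i))
  -- ([m,b],[m/ξ^i,b]) : m' = m/ξ^i  iff  m' ξ^i = m
  arc (line m b) (line m' b') =
    anyUpTo k (λ i → (v m' * ξ ^ i) == v m) ∧ (b' == b)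
  arc (Pv m) (Pv m') = anyUpTo k (λ i → (v m' * ξ ^ i) == v m)
  arc _ _ = false

  H : MixedGraph
  H = record { V = Vtx ; E = edge ; A = arc }

-- Arcs keep the type of a vertex and its second coordinate, and multiply the
-- first coordinate of points and L's (divide that of lines and P's) by ξ^i with
-- 1 ≤ i ≤ k; edges join {points, P's} to {lines, L's}, so closed walks use an
-- even number of edges. In a closed walk of length at most 4 that uses an arc,
-- the incidence equations of its (at most two) edges force a nonzero product of
-- coordinates to be fixed by ξ^e for some 1 ≤ e ≤ 4k, impossible because the
-- primitive element ξ has order q - 1 > 4k. A closed walk of four edges would
-- repeat a vertex or put two points on two lines. Neighbourhoods are parametrised
-- by the exponent i ∈ [1, k] for arcs, and for edges by the slope (resp. abscissa),
-- with 0 standing for L_x (resp. P_m). Finally L_1 → L_ξ — (ξ,ξ) — [1,0] — (1,1) — L_1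
-- is a 5-cycle.

module Submission where

open import Defs
open import Level using (0ℓ)
open import Algebra.Bundles using (CommutativeRing)
open import Algebra.Structures using (IsCommutativeRing)
open import Axiom.UniquenessOfIdentityProofs using (module Decidable⇒UIP)
open import Data.Bool as Bool using (Bool; true; false; _∧_; not; if_then_else_)
open import Data.Bool.Properties using (not-¬; not-involutive; ¬-not; ∨-zeroʳ)
open import Data.Empty using (⊥; ⊥-elim)
open import Data.Unit using (tt)
open import Data.Fin as Fin using (Fin; toℕ; fromℕ<; #_)
import Data.Fin.Properties as FinP
open import Data.Maybe using (Maybe; just; nothing)
open import Data.Nat as ℕ using (ℕ; zero; suc; _≤_; _<_; _∸_; z≤n; s≤s)
import Data.Nat.Properties as ℕP
open import Data.Product using (Σ; ∃; _×_; _,_; proj₁; proj₂)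
open import Data.Sum using (_⊎_; inj₁; inj₂)
open import Function.Base using (_∘_; case_of_)
open import Function.Bundles using (_↔_; Inverse; mk⤖; mk↔ₛ′)
open import Function.Consequences.Propositional using (strictlySurjective⇒surjective)
open import Function.Definitions using (Injective)
open import Function.Properties.Bijection using (⤖⇒↔)
open import Function.Properties.Inverse using (↔-trans; ↔-sym)
open import Relation.Nullary using (Dec; yes; no)
open import Relation.Binary.Definitions using (tri<; tri≈; tri>)
open import Relation.Binary.PropositionalEquality

∧-true : ∀ {a b} → a ∧ b ≡ true → a ≡ true × b ≡ true
∧-true {true} b≡true = refl , b≡true

subset-≡ : ∀ {A : Set} {P : A → Bool} {b : Bool} {x y : A} {p : P x ≡ b} {p′ : P y ≡ b} →
           x ≡ y → _≡_ {A = Σ A λ z → P z ≡ b} (x , p) (y , p′)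
subset-≡ refl = cong (_ ,_) (Decidable⇒UIP.≡-irrelevant Bool._≟_ _ _)

↔-subset : ∀ {A B : Set} {P : B → Bool} (f : A → B) → Injective _≡_ _≡_ f →
           (∀ a → P (f a) ≡ true) → (∀ b → P b ≡ true → ∃ λ a → f a ≡ b) →
           A ↔ Σ B (λ b → P b ≡ true)
↔-subset f f-injective f-in onto = ⤖⇒↔ (mk⤖ {to = λ a → f a , f-in a}
  ( (λ e → f-injective (cong proj₁ e))
  , strictlySurjective⇒surjective (λ (b , Pb) → proj₁ (onto b Pb) , subset-≡ (proj₂ (onto b Pb)))))

↔-range : ∀ {B : Set} {P : B → Bool} {k} (f : ℕ → B) →
          (∀ {i j} → i ≤ k → j ≤ k → f i ≡ f j → i ≡ j) →
          (∀ {i} → 1 ≤ i → i ≤ k → P (f i) ≡ true) →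
          (∀ b → P b ≡ true → ∃ λ i → 1 ≤ i × i ≤ k × f i ≡ b) →
          Fin k ↔ Σ B (λ b → P b ≡ true)
↔-range f f-injective f-in onto = ↔-subset (λ j → f (suc (toℕ j)))
  (λ e → FinP.toℕ-injective (ℕP.suc-injective (f-injective (FinP.toℕ<n _) (FinP.toℕ<n _) e)))
  (λ j → f-in (s≤s z≤n) (FinP.toℕ<n j))
  (λ b Pb → index (onto b Pb))
  where
    index : ∀ {b} → (∃ λ i → 1 ≤ i × i ≤ _ × f i ≡ b) → ∃ λ j → f (suc (toℕ j)) ≡ b
    index (suc i , _ , i<k , fi≡b) = fromℕ< i<k , trans (cong (f ∘ suc) (FinP.toℕ-fromℕ< i<k)) fi≡b

enumeration⇒≤ : ∀ {C : Set} {q m} → C ↔ Fin q → (f : Fin m → C) → (∀ c → ∃ λ i → f i ≡ c) → q ≤ m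
enumeration⇒≤ card f onto = FinP.injective⇒≤ {f = λ a → preimage (from a)} injective
  where
    open Inverse card
    preimage : _ → Fin _
    preimage c = proj₁ (onto c)
    injective : ∀ {a b} → preimage (from a) ≡ preimage (from b) → a ≡ b
    injective {a} {b} e = begin
      a                        ≡⟨ strictlyInverseˡ a ⟨
      to (from a)              ≡⟨ cong to (trans (sym (proj₂ (onto (from a)))) (trans (cong f e) (proj₂ (onto (from b))))) ⟩
      to (from b)              ≡⟨ strictlyInverseˡ b ⟩
      b                        ∎
      where open ≡-Reasoning

module FieldProperties {q : ℕ} (F : FiniteField q) where
  open FiniteField F
  open IsCommutativeRing isCommutativeRing
    using (+-assoc; +-comm; +-identityˡ; +-identityʳ; -‿inverseʳ; *-assoc; *-comm; *-identityˡ; *-identityʳ; zeroʳ; distribˡ)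

  commutativeRing : CommutativeRing 0ℓ 0ℓ
  commutativeRing = record { isCommutativeRing = isCommutativeRing }

  ==⇒≡ : ∀ {x y} → (x == y) ≡ true → x ≡ y
  ==⇒≡ {x} {y} x==y with x ≟ y
  ... | yes x≡y = x≡y

  ≡⇒== : ∀ {x y} → x ≡ y → (x == y) ≡ true
  ≡⇒== {x} {y} x≡y with x ≟ y
  ... | yes _   = refl
  ... | no x≢y = ⊥-elim (x≢y x≡y)

  ≢⇒== : ∀ {x y} → x ≢ y → (x == y) ≡ false
  ≢⇒== {x} {y} x≢y with x ≟ y
  ... | yes x≡y = ⊥-elim (x≢y x≡y)
  ... | no _    = refl

  nonzero : (x : Nonzero) → proj₁ x ≢ 0#
  nonzero (x , x==0≡false) x≡0 = case trans (sym (≡⇒== x≡0)) x==0≡false of λ ()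

  toNonzero : (x : Carrier) → x ≢ 0# → Nonzero
  toNonzero x x≢0 = x , ≢⇒== x≢0

  Nonzero-≡ : {x y : Nonzero} → proj₁ x ≡ proj₁ y → x ≡ y
  Nonzero-≡ = subset-≡

  Carrier↔MaybeNonzero : Carrier ↔ Maybe Nonzero
  Carrier↔MaybeNonzero = mk↔ₛ′ classify forget classify-forget (λ x → forget-classify x (x ≟ 0#))
    where
      classify′ : (x : Carrier) → Dec (x ≡ 0#) → Maybe Nonzero
      classify′ x (yes _)   = nothing
      classify′ x (no x≢0) = just (toNonzero x x≢0)
      classify : Carrier → Maybe Nonzero
      classify x = classify′ x (x ≟ 0#)
      forget : Maybe Nonzero → Carrier
      forget nothing  = 0#
      forget (just x) = proj₁ x
      forget-classify : ∀ x d → forget (classify′ x d) ≡ x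
      forget-classify x (yes x≡0) = sym x≡0
      forget-classify x (no _)    = refl
      classify-forget : ∀ m → classify (forget m) ≡ m
      classify-forget nothing with 0# ≟ 0#
      ... | yes _   = refl
      ... | no 0≢0 = ⊥-elim (0≢0 refl)
      classify-forget (just x) with proj₁ x ≟ 0#
      ... | yes x≡0 = ⊥-elim (nonzero x x≡0)
      ... | no _    = cong just (Nonzero-≡ refl)

  *-cancelˡ : ∀ {x a b} → x ≢ 0# → x * a ≡ x * b → a ≡ b
  *-cancelˡ {x} {a} {b} x≢0 xa≡xb = begin
    a             ≡⟨ cancel a ⟨
    y * (x * a)   ≡⟨ cong (y *_) xa≡xb ⟩
    y * (x * b)   ≡⟨ cancel b ⟩
    b             ∎
    where
      open ≡-Reasoning
      y = proj₁ (inverse x x≢0)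
      cancel : ∀ c → y * (x * c) ≡ c
      cancel c = begin
        y * (x * c) ≡⟨ *-assoc y x c ⟨
        y * x * c   ≡⟨ cong (_* c) (trans (*-comm y x) (proj₂ (inverse x x≢0))) ⟩
        1# * c      ≡⟨ *-identityˡ c ⟩
        c           ∎

  *-cancelʳ : ∀ {x a b} → x ≢ 0# → a * x ≡ b * x → a ≡ b
  *-cancelʳ {x} {a} {b} x≢0 ax≡bx = *-cancelˡ x≢0 (trans (*-comm x a) (trans ax≡bx (*-comm b x)))

  *-nonzero : ∀ {x y} → x ≢ 0# → y ≢ 0# → x * y ≢ 0#
  *-nonzero {x} x≢0 y≢0 xy≡0 = y≢0 (*-cancelˡ x≢0 (trans xy≡0 (sym (zeroʳ x))))

  inverse-nonzero : ∀ {x y} → x * y ≡ 1# → y ≢ 0#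
  inverse-nonzero {x} xy≡1 y≡0 = 0≢1 (trans (sym (zeroʳ x)) (trans (cong (x *_) (sym y≡0)) xy≡1))

  ^-+ : ∀ x i j → x ^ (i ℕ.+ j) ≡ x ^ i * x ^ j
  ^-+ x zero    j = sym (*-identityˡ _)
  ^-+ x (suc i) j = trans (cong (x *_) (^-+ x i j)) (sym (*-assoc x (x ^ i) (x ^ j)))

  ^-nonzero : ∀ {x} → x ≢ 0# → ∀ i → x ^ i ≢ 0#
  ^-nonzero x≢0 zero    1≡0 = 0≢1 (sym 1≡0)
  ^-nonzero x≢0 (suc i) = *-nonzero x≢0 (^-nonzero x≢0 i)

  open import Algebra.Properties.AbelianGroup (CommutativeRing.+-abelianGroup commutativeRing)
    using (∙-cancelˡ; ∙-cancelʳ; x∙y⁻¹≈ε⇒x≈y; ⁻¹-∙-comm)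
  open import Algebra.Properties.CommutativeSemigroup (CommutativeRing.+-commutativeSemigroup commutativeRing)
    using () renaming (interchange to +-interchange)
  open import Algebra.Properties.CommutativeSemigroup (CommutativeRing.*-commutativeSemigroup commutativeRing)
    public using () renaming (interchange to *-interchange)
  open import Algebra.Properties.Ring (CommutativeRing.ring commutativeRing) using (-‿distribʳ-*)

  infixl 6 _-_
  _-_ : Carrier → Carrier → Carrier
  x - y = x + - y

  affine-difference : ∀ m x x′ b → (m * x + b) - (m * x′ + b) ≡ m * (x - x′)
  affine-difference m x x′ b = begin
    (m * x + b) - (m * x′ + b)         ≡⟨ cong ((m * x + b) +_) (⁻¹-∙-comm (m * x′) b) ⟨
    (m * x + b) + (- (m * x′) + - b)   ≡⟨ +-interchange (m * x) b (- (m * x′)) (- b) ⟩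
    (m * x - m * x′) + (b - b)         ≡⟨ cong ((m * x - m * x′) +_) (-‿inverseʳ b) ⟩
    (m * x - m * x′) + 0#              ≡⟨ +-identityʳ _ ⟩
    m * x + - (m * x′)                 ≡⟨ cong (m * x +_) (-‿distribʳ-* m x′) ⟩
    m * x + m * - x′                   ≡⟨ distribˡ m x (- x′) ⟨
    m * (x - x′)                       ∎
    where open ≡-Reasoning

  +-minus : ∀ a y → a + (y - a) ≡ y
  +-minus a y = begin
    a + (y - a)    ≡⟨ cong (a +_) (+-comm y (- a)) ⟩
    a + (- a + y)  ≡⟨ +-assoc a (- a) y ⟨
    (a - a) + y    ≡⟨ cong (_+ y) (-‿inverseʳ a) ⟩
    0# + y         ≡⟨ +-identityˡ y ⟩
    y              ∎
    where open ≡-Reasoning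

  intercept : ∀ {y a b} → y ≡ a + b → b ≡ y - a
  intercept {y} {a} {b} y≡a+b = ∙-cancelˡ a b (y - a) (trans (sym y≡a+b) (sym (+-minus a y)))

  +-cancelʳ : ∀ {a b c} → a + c ≡ b + c → a ≡ b
  +-cancelʳ = ∙-cancelʳ _ _ _

  intercept-unique : ∀ {y m x b b′} → y ≡ m * x + b → y ≡ m * x + b′ → b ≡ b′
  intercept-unique {m = m} {x} {b} {b′} e e′ = ∙-cancelˡ (m * x) b b′ (trans (sym e) e′)

  two-points-two-lines : ∀ {x x′ y y′ m m′ b b′} →
    y ≡ m * x + b → y′ ≡ m * x′ + b → y′ ≡ m′ * x′ + b′ → y ≡ m′ * x + b′ →
    (x ≡ x′ × y ≡ y′) ⊎ (m ≡ m′ × b ≡ b′)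
  two-points-two-lines {x} {x′} {y} {y′} {m} {m′} {b} {b′} e₁ e₂ e₃ e₄ with (x - x′) ≟ 0#
  ... | yes x-x′≡0 = inj₁ (x≡x′ , trans e₁ (trans (cong (λ t → m * t + b) x≡x′) (sym e₂)))
    where x≡x′ = x∙y⁻¹≈ε⇒x≈y x x′ x-x′≡0
  ... | no x-x′≢0 = inj₂ (m≡m′ , intercept-unique (trans e₁ (cong (λ t → t * x + b) m≡m′)) e₄)
    where
      m≡m′ : m ≡ m′
      m≡m′ = *-cancelʳ x-x′≢0 (begin
        m * (x - x′)                 ≡⟨ affine-difference m x x′ b ⟨
        (m * x + b) - (m * x′ + b)   ≡⟨ cong₂ _-_ e₁ e₂ ⟨
        y - y′                       ≡⟨ cong₂ _-_ e₄ e₃ ⟩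
        (m′ * x + b′) - (m′ * x′ + b′) ≡⟨ affine-difference m′ x x′ b′ ⟩
        m′ * (x - x′)                ∎)
        where open ≡-Reasoning

  ^-reduce : ∀ {ξ n} → 1 ≤ n → ξ ^ n ≡ 1# → ∀ i → ∃ λ j → j < n × ξ ^ i ≡ ξ ^ j
  ^-reduce 1≤n ξ^n≡1 zero = 0 , 1≤n , refl
  ^-reduce {ξ} {n} 1≤n ξ^n≡1 (suc i) with ^-reduce 1≤n ξ^n≡1 i
  ... | j , j<n , ξ^i≡ξ^j with suc j ℕ.<? n
  ...   | yes 1+j<n = suc j , 1+j<n , cong (ξ *_) ξ^i≡ξ^j
  ...   | no 1+j≮n = 0 , 1≤n , (begin
    ξ * ξ ^ i      ≡⟨ cong (ξ *_) ξ^i≡ξ^j ⟩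
    ξ ^ suc j      ≡⟨ cong (ξ ^_) (ℕP.≤-antisym j<n (ℕP.≮⇒≥ 1+j≮n)) ⟩
    ξ ^ n          ≡⟨ ξ^n≡1 ⟩
    1#             ∎)
    where open ≡-Reasoning

  primitive⇒q≤1+n : ∀ {ξ n} → IsPrimitive ξ → 1 ≤ n → ξ ^ n ≡ 1# → q ≤ suc n
  primitive⇒q≤1+n {ξ} {n} (_ , generates) 1≤n ξ^n≡1 = enumeration⇒≤ card element covers
    where
      element : Fin (suc n) → Carrier
      element Fin.zero    = 0#
      element (Fin.suc j) = ξ ^ toℕ j
      covers : ∀ c → ∃ λ i → element i ≡ c
      covers c with c ≟ 0#
      ... | yes c≡0 = Fin.zero , sym c≡0
      ... | no c≢0 with generates c c≢0
      ...   | i , ξ^i≡c with ^-reduce 1≤n ξ^n≡1 i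
      ...     | j , j<n , ξ^i≡ξ^j =
        Fin.suc (fromℕ< j<n) , trans (cong (ξ ^_) (FinP.toℕ-fromℕ< j<n)) (trans (sym ξ^i≡ξ^j) ξ^i≡c)

  primitive-order : ∀ {ξ e} → IsPrimitive ξ → 1 ≤ e → e < q ∸ 1 → ξ ^ e ≢ 1#
  primitive-order {e = e} ξ-primitive 1≤e e<q-1 ξ^e≡1 =
    ℕP.<⇒≱ e<q-1 (ℕP.∸-monoˡ-≤ 1 (primitive⇒q≤1+n ξ-primitive 1≤e ξ^e≡1))

module HProperties {q : ℕ} (F : FiniteField q) (k : ℕ) (ξ : FiniteField.Carrier F) where
  open FiniteField F
  open FieldProperties F
  open IsCommutativeRing isCommutativeRing using (+-identityʳ; *-assoc; *-comm; *-identityˡ; *-identityʳ)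
  open Construction F k ξ

  anyUpTo⇒∃ : ∀ n f → anyUpTo n f ≡ true → ∃ λ i → 1 ≤ i × i ≤ n × f i ≡ true
  anyUpTo⇒∃ (suc n) f any with f (suc n) in f[1+n]
  ... | true  = suc n , s≤s z≤n , ℕP.≤-refl , f[1+n]
  ... | false with anyUpTo⇒∃ n f any
  ...   | i , 1≤i , i≤n , fi = i , 1≤i , ℕP.m≤n⇒m≤1+n i≤n , fi

  ∃⇒anyUpTo : ∀ n f {i} → 1 ≤ i → i ≤ n → f i ≡ true → anyUpTo n f ≡ true
  ∃⇒anyUpTo zero    f (s≤s _) ()
  ∃⇒anyUpTo (suc n) f 1≤i i≤1+n fi with ℕP.m≤n⇒m<n∨m≡n i≤1+n
  ... | inj₂ refl rewrite fi = refl
  ... | inj₁ i<1+n rewrite ∃⇒anyUpTo n f 1≤i (ℕ.s≤s⁻¹ i<1+n) fi = ∨-zeroʳ (f (suc n))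

  module _ (ξ≢0 : ξ ≢ 0#) (ξ^e≢1 : ∀ e → 1 ≤ e → e ≤ 4 ℕ.* k → ξ ^ e ≢ 1#) where

    ξ^-distinct : ∀ {i j} → i < j → j ≤ 4 ℕ.* k → ξ ^ i ≢ ξ ^ j
    ξ^-distinct {i} {j} i<j j≤4k ξ^i≡ξ^j =
      ξ^e≢1 (j ∸ i) (ℕP.m<n⇒0<n∸m i<j) (ℕP.≤-trans (ℕP.m∸n≤m j i) j≤4k)
        (*-cancelˡ (^-nonzero ξ≢0 i) (begin
          ξ ^ i * ξ ^ (j ∸ i)  ≡⟨ ^-+ ξ i (j ∸ i) ⟨
          ξ ^ (i ℕ.+ (j ∸ i))  ≡⟨ cong (ξ ^_) (ℕP.m+[n∸m]≡n (ℕP.<⇒≤ i<j)) ⟩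
          ξ ^ j                ≡⟨ ξ^i≡ξ^j ⟨
          ξ ^ i                ≡⟨ *-identityʳ (ξ ^ i) ⟨
          ξ ^ i * 1#           ∎))
      where open ≡-Reasoning

    ≤k⇒≤4k : ∀ {e} → e ≤ k → e ≤ 4 ℕ.* k
    ≤k⇒≤4k = ℕP.m≤n⇒m≤n+o (3 ℕ.* k)

    ξ^-injective : ∀ {i j} → i ≤ 4 ℕ.* k → j ≤ 4 ℕ.* k → ξ ^ i ≡ ξ ^ j → i ≡ j
    ξ^-injective {i} {j} i≤4k j≤4k ξ^i≡ξ^j with ℕP.<-cmp i j
    ... | tri< i<j _ _ = ⊥-elim (ξ^-distinct i<j j≤4k ξ^i≡ξ^j)
    ... | tri≈ _ i≡j _ = i≡j
    ... | tri> _ _ j<i = ⊥-elim (ξ^-distinct j<i i≤4k (sym ξ^i≡ξ^j))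

    ξ⁻ : ℕ → Carrier
    ξ⁻ e = proj₁ (inverse (ξ ^ e) (^-nonzero ξ≢0 e))

    ξ^*ξ⁻ : ∀ e → ξ ^ e * ξ⁻ e ≡ 1#
    ξ^*ξ⁻ e = proj₂ (inverse (ξ ^ e) (^-nonzero ξ≢0 e))

    ξ⁻-nonzero : ∀ e → ξ⁻ e ≢ 0#
    ξ⁻-nonzero e = inverse-nonzero (ξ^*ξ⁻ e)

    *ξ⁻*ξ^ : ∀ a e → a * ξ⁻ e * ξ ^ e ≡ a
    *ξ⁻*ξ^ a e = begin
      a * ξ⁻ e * ξ ^ e    ≡⟨ *-assoc a (ξ⁻ e) (ξ ^ e) ⟩
      a * (ξ⁻ e * ξ ^ e)  ≡⟨ cong (a *_) (trans (*-comm (ξ⁻ e) (ξ ^ e)) (ξ^*ξ⁻ e)) ⟩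
      a * 1#              ≡⟨ *-identityʳ a ⟩
      a                   ∎
      where open ≡-Reasoning

    ≡*ξ^⇒*ξ⁻≡ : ∀ {a a′} e → a ≡ a′ * ξ ^ e → a * ξ⁻ e ≡ a′
    ≡*ξ^⇒*ξ⁻≡ e a≡a′ξ^e =
      *-cancelʳ (^-nonzero ξ≢0 e) (trans (*ξ⁻*ξ^ _ e) a≡a′ξ^e)

    ξ⁻-injective : ∀ {e e′} → ξ⁻ e ≡ ξ⁻ e′ → ξ ^ e ≡ ξ ^ e′
    ξ⁻-injective {e} {e′} ξ⁻e≡ξ⁻e′ = *-cancelʳ (ξ⁻-nonzero e)
      (trans (ξ^*ξ⁻ e) (trans (sym (ξ^*ξ⁻ e′)) (cong (ξ ^ e′ *_) (sym ξ⁻e≡ξ⁻e′))))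

    infixl 7 _·ξ^_ _·ξ⁻_
    _·ξ^_ _·ξ⁻_ : Nonzero → ℕ → Nonzero
    x ·ξ^ e = toNonzero (proj₁ x * ξ ^ e) (*-nonzero (nonzero x) (^-nonzero ξ≢0 e))
    x ·ξ⁻ e = toNonzero (proj₁ x * ξ⁻ e) (*-nonzero (nonzero x) (ξ⁻-nonzero e))

    -- a′ = a ξ^e where e is a sum of n exponents from [1, k].
    record Shift (n : ℕ) (a a′ : Carrier) : Set where
      constructor shift
      field
        exponent : ℕ
        lower    : n ≤ exponent
        upper    : exponent ≤ n ℕ.* k
        a′≡aξ^e  : a′ ≡ a * ξ ^ exponent

    Shift-refl : ∀ a → Shift 0 a a
    Shift-refl a = shift 0 z≤n z≤n (sym (*-identityʳ a))

    exponent-bounds-+ : ∀ {n m e f} → n ≤ e → e ≤ n ℕ.* k → m ≤ f → f ≤ m ℕ.* k →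
                        n ℕ.+ m ≤ e ℕ.+ f × e ℕ.+ f ≤ (n ℕ.+ m) ℕ.* k
    exponent-bounds-+ {n} {m} {e} {f} n≤e e≤nk m≤f f≤mk =
      ℕP.+-mono-≤ n≤e m≤f , subst (e ℕ.+ f ≤_) (sym (ℕP.*-distribʳ-+ k n m)) (ℕP.+-mono-≤ e≤nk f≤mk)

    Shift-trans : ∀ {n m a b c} → Shift n a b → Shift m b c → Shift (n ℕ.+ m) a c
    Shift-trans {a = a} (shift e n≤e e≤nk b≡aξ^e) (shift f m≤f f≤mk c≡bξ^f) =
      shift (e ℕ.+ f) lower upper (begin
        _                    ≡⟨ c≡bξ^f ⟩
        _ * ξ ^ f            ≡⟨ cong (_* ξ ^ f) b≡aξ^e ⟩
        a * ξ ^ e * ξ ^ f    ≡⟨ *-assoc a (ξ ^ e) (ξ ^ f) ⟩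
        a * (ξ ^ e * ξ ^ f)  ≡⟨ cong (a *_) (^-+ ξ e f) ⟨
        a * ξ ^ (e ℕ.+ f)    ∎)
      where
        open ≡-Reasoning
        lower = proj₁ (exponent-bounds-+ n≤e e≤nk m≤f f≤mk)
        upper = proj₂ (exponent-bounds-+ n≤e e≤nk m≤f f≤mk)

    Shift-* : ∀ {n m a b c d} → Shift n a b → Shift m c d → Shift (n ℕ.+ m) (a * c) (b * d)
    Shift-* {a = a} {c = c} (shift e n≤e e≤nk b≡aξ^e) (shift f m≤f f≤mk d≡cξ^f) =
      shift (e ℕ.+ f) lower upper (begin
        _ * _                        ≡⟨ cong₂ _*_ b≡aξ^e d≡cξ^f ⟩
        a * ξ ^ e * (c * ξ ^ f)      ≡⟨ *-interchange a (ξ ^ e) c (ξ ^ f) ⟩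
        a * c * (ξ ^ e * ξ ^ f)      ≡⟨ cong (a * c *_) (^-+ ξ e f) ⟨
        a * c * ξ ^ (e ℕ.+ f)        ∎)
      where
        open ≡-Reasoning
        lower = proj₁ (exponent-bounds-+ n≤e e≤nk m≤f f≤mk)
        upper = proj₂ (exponent-bounds-+ n≤e e≤nk m≤f f≤mk)

    no-short-return : ∀ {n a a′} → a ≢ 0# → Shift n a a′ → a′ ≡ a → 1 ≤ n → n ≤ 4 → ⊥
    no-short-return {a = a} a≢0 (shift e n≤e e≤nk a′≡aξ^e) a′≡a 1≤n n≤4 =
      ξ^e≢1 e (ℕP.≤-trans 1≤n n≤e) (ℕP.≤-trans e≤nk (ℕP.*-monoˡ-≤ k n≤4))
        (*-cancelˡ a≢0 (trans (sym a′≡aξ^e) (trans a′≡a (sym (*-identityʳ a)))))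

    Shift-+-comm : ∀ {n m a a′} → Shift (n ℕ.+ m) a a′ → Shift (m ℕ.+ n) a a′
    Shift-+-comm {n} {m} {a} {a′} = subst (λ i → Shift i a a′) (ℕP.+-comm n m)

    Shift-trans˘ : ∀ {n m a b c} → Shift n b c → Shift m a b → Shift (n ℕ.+ m) a c
    Shift-trans˘ {n} {m} t s = Shift-+-comm {m} {n} (Shift-trans s t)

    infix 4 _⇝⟨_⟩_ _—_

    -- Walks of n arcs; on lines and P's arcs divide the coordinate, hence the reversed Shift.
    data _⇝⟨_⟩_ : Vtx → ℕ → Vtx → Set where
      points : ∀ {n x x′ y} → Shift n (proj₁ x) (proj₁ x′) → pt x y ⇝⟨ n ⟩ pt x′ y
      Ls     : ∀ {n x x′}   → Shift n (proj₁ x) (proj₁ x′) → Lv x ⇝⟨ n ⟩ Lv x′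
      lines  : ∀ {n m m′ b} → Shift n (proj₁ m′) (proj₁ m) → line m b ⇝⟨ n ⟩ line m′ b
      Ps     : ∀ {n m m′}   → Shift n (proj₁ m′) (proj₁ m) → Pv m ⇝⟨ n ⟩ Pv m′

    ⇝-refl : ∀ u → u ⇝⟨ 0 ⟩ u
    ⇝-refl (pt x y)   = points (Shift-refl (proj₁ x))
    ⇝-refl (line m b) = lines (Shift-refl (proj₁ m))
    ⇝-refl (Lv x)     = Ls (Shift-refl (proj₁ x))
    ⇝-refl (Pv m)     = Ps (Shift-refl (proj₁ m))

    infixr 5 _⨾_
    _⨾_ : ∀ {u v w n m} → u ⇝⟨ n ⟩ v → v ⇝⟨ m ⟩ w → u ⇝⟨ n ℕ.+ m ⟩ w
    points s ⨾ points t = points (Shift-trans s t)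
    Ls s     ⨾ Ls t     = Ls (Shift-trans s t)
    lines s  ⨾ lines t  = lines (Shift-trans˘ s t)
    Ps s     ⨾ Ps t     = Ps (Shift-trans˘ s t)

    ⇝-irreflexive : ∀ {u n} → u ⇝⟨ n ⟩ u → 1 ≤ n → n ≤ 4 → ⊥
    ⇝-irreflexive (points {x = x} s) = no-short-return (nonzero x) s refl
    ⇝-irreflexive (Ls {x = x} s)     = no-short-return (nonzero x) s refl
    ⇝-irreflexive (lines {m = m} s)  = no-short-return (nonzero m) s refl
    ⇝-irreflexive (Ps {m = m} s)     = no-short-return (nonzero m) s refl

    data _—_ : Vtx → Vtx → Set where
      pt—line : ∀ {x y m b} → y ≡ proj₁ m * proj₁ x + b → pt x y — line m b
      line—pt : ∀ {x y m b} → y ≡ proj₁ m * proj₁ x + b → line m b — pt x y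
      pt—L    : ∀ {x y} → pt x y — Lv x
      L—pt    : ∀ {x y} → Lv x — pt x y
      line—P  : ∀ {m b} → line m b — Pv m
      P—line  : ∀ {m b} → Pv m — line m b

    shift₁ : ∀ {a a′ i} → 1 ≤ i → i ≤ k → a′ ≡ a * ξ ^ i → Shift 1 a a′
    shift₁ 1≤i i≤k = shift _ 1≤i (ℕP.m≤n⇒m≤n+o 0 i≤k)

    multiplied : ∀ a a′ → anyUpTo k (λ i → a′ == (a * ξ ^ i)) ≡ true → Shift 1 a a′
    multiplied a a′ any with anyUpTo⇒∃ k _ any
    ... | i , 1≤i , i≤k , hit = shift₁ 1≤i i≤k (==⇒≡ hit)

    divided : ∀ a a′ → anyUpTo k (λ i → (a′ * ξ ^ i) == a) ≡ true → Shift 1 a′ a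
    divided a a′ any with anyUpTo⇒∃ k _ any
    ... | i , 1≤i , i≤k , hit = shift₁ 1≤i i≤k (sym (==⇒≡ hit))

    arc⇒⇝ : ∀ u w → arc u w ≡ true → u ⇝⟨ 1 ⟩ w
    arc⇒⇝ (pt x y) (pt x′ y′) a with ∧-true {anyUpTo k _} a
    ... | up , y′==y with ==⇒≡ {y′} {y} y′==y
    ...   | refl = points (multiplied (proj₁ x) (proj₁ x′) up)
    arc⇒⇝ (line m b) (line m′ b′) a with ∧-true {anyUpTo k _} a
    ... | down , b′==b with ==⇒≡ {b′} {b} b′==b
    ...   | refl = lines (divided (proj₁ m) (proj₁ m′) down)
    arc⇒⇝ (Lv x) (Lv x′) a = Ls (multiplied (proj₁ x) (proj₁ x′) a)
    arc⇒⇝ (Pv m) (Pv m′) a = Ps (divided (proj₁ m) (proj₁ m′) a)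
    arc⇒⇝ (pt _ _)   (line _ _) ()
    arc⇒⇝ (pt _ _)   (Lv _)     ()
    arc⇒⇝ (pt _ _)   (Pv _)     ()
    arc⇒⇝ (line _ _) (pt _ _)   ()
    arc⇒⇝ (line _ _) (Lv _)     ()
    arc⇒⇝ (line _ _) (Pv _)     ()
    arc⇒⇝ (Lv _)     (pt _ _)   ()
    arc⇒⇝ (Lv _)     (line _ _) ()
    arc⇒⇝ (Lv _)     (Pv _)     ()
    arc⇒⇝ (Pv _)     (pt _ _)   ()
    arc⇒⇝ (Pv _)     (line _ _) ()
    arc⇒⇝ (Pv _)     (Lv _)     ()

    edge⇒— : ∀ u w → edge u w ≡ true → u — w
    edge⇒— (pt x y)   (line m b) e = pt—line (==⇒≡ e)
    edge⇒— (line m b) (pt x y)   e = line—pt (==⇒≡ e)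
    edge⇒— (pt x y)   (Lv i)     e with Nonzero-≡ {x} {i} (==⇒≡ e)
    ... | refl = pt—L
    edge⇒— (Lv i)     (pt x y)   e with Nonzero-≡ {x} {i} (==⇒≡ e)
    ... | refl = L—pt
    edge⇒— (line m b) (Pv i)     e with Nonzero-≡ {m} {i} (==⇒≡ e)
    ... | refl = line—P
    edge⇒— (Pv i)     (line m b) e with Nonzero-≡ {m} {i} (==⇒≡ e)
    ... | refl = P—line
    edge⇒— (pt _ _)   (pt _ _)   ()
    edge⇒— (pt _ _)   (Pv _)     ()
    edge⇒— (line _ _) (line _ _) ()
    edge⇒— (line _ _) (Lv _)     ()
    edge⇒— (Lv _)     (line _ _) ()
    edge⇒— (Lv _)     (Lv _)     ()
    edge⇒— (Lv _)     (Pv _)     ()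
    edge⇒— (Pv _)     (pt _ _)   ()
    edge⇒— (Pv _)     (Lv _)     ()
    edge⇒— (Pv _)     (Pv _)     ()

    side : Vtx → Bool
    side (pt _ _)   = true
    side (Pv _)     = true
    side (line _ _) = false
    side (Lv _)     = false

    ⇝-side : ∀ {u w n} → u ⇝⟨ n ⟩ w → side u ≡ side w
    ⇝-side (points _) = refl
    ⇝-side (Ls _)     = refl
    ⇝-side (lines _)  = refl
    ⇝-side (Ps _)     = refl

    —-side : ∀ {u w} → u — w → side w ≡ not (side u)
    —-side (pt—line _) = refl
    —-side (line—pt _) = refl
    —-side pt—L        = refl
    —-side L—pt        = refl
    —-side line—P      = refl
    —-side P—line      = refl

    no-closed-walk-with-one-edge : ∀ {u v n} → u — v → v ⇝⟨ n ⟩ u → ⊥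
    no-closed-walk-with-one-edge e r = not-¬ refl (trans (sym (⇝-side r)) (—-side e))

    no-closed-walk-with-three-edges : ∀ {u v w z n} → u — v → v — w → w — z → z ⇝⟨ n ⟩ u → ⊥
    no-closed-walk-with-three-edges {u} {v} {w} {z} e₁ e₂ e₃ r = not-¬ refl (begin
      side u                ≡⟨ ⇝-side r ⟨
      side z                ≡⟨ —-side e₃ ⟩
      not (side w)          ≡⟨ cong not (—-side e₂) ⟩
      not (not (side v))    ≡⟨ not-involutive (side v) ⟩
      side v                ≡⟨ —-side e₁ ⟩
      not (side u)          ∎)
      where open ≡-Reasoning

    no-closed-walk-with-two-edges : ∀ {u v w z a b} → u — v → v ⇝⟨ a ⟩ w → w — z → z ⇝⟨ b ⟩ u →
                                    1 ≤ a ℕ.+ b → a ℕ.+ b ≤ 4 → ⊥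
    no-closed-walk-with-two-edges (pt—line {x} {m = m} e₁) (lines s) (line—pt {x′} {m = m′} e₂) (points t) =
      no-short-return (*-nonzero (nonzero m′) (nonzero x′)) (Shift-* s t) (+-cancelʳ (trans (sym e₁) e₂))
    no-closed-walk-with-two-edges {a = a} {b} (line—pt {x} {m = m} e₁) (points s) (pt—line e₂) (lines t) =
      no-short-return (*-nonzero (nonzero m) (nonzero x)) (Shift-+-comm {b} {a} (Shift-* t s)) (+-cancelʳ (trans (sym e₂) e₁))
    no-closed-walk-with-two-edges (pt—L {x}) (Ls s) L—pt (points t) =
      no-short-return (nonzero x) (Shift-trans s t) refl
    no-closed-walk-with-two-edges (L—pt {x}) (points s) pt—L (Ls t) =
      no-short-return (nonzero x) (Shift-trans s t) refl
    no-closed-walk-with-two-edges (line—P {m}) (Ps s) P—line (lines t) =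
      no-short-return (nonzero m) (Shift-trans˘ s t) refl
    no-closed-walk-with-two-edges (P—line {m}) (lines s) line—P (Ps t) =
      no-short-return (nonzero m) (Shift-trans˘ s t) refl

    -- The edges form the incidence graph of a partial linear space.
    no-4-cycle-of-edges : ∀ {u v w z} → u — v → v — w → w — z → z — u → u ≢ w → v ≢ z → ⊥
    no-4-cycle-of-edges (pt—line e₁) (line—pt e₂) (pt—line e₃) (line—pt e₄) u≢w v≢z
      with two-points-two-lines e₁ e₂ e₃ e₄
    ... | inj₁ (x≡x′ , y≡y′) = u≢w (cong₂ pt (Nonzero-≡ x≡x′) y≡y′)
    ... | inj₂ (m≡m′ , c≡c′) = v≢z (cong₂ line (Nonzero-≡ m≡m′) c≡c′)
    no-4-cycle-of-edges (line—pt e₁) (pt—line e₂) (line—pt e₃) (pt—line e₄) u≢w v≢z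
      with two-points-two-lines e₁ e₄ e₃ e₂
    ... | inj₁ (x≡x′ , y≡y′) = v≢z (cong₂ pt (Nonzero-≡ x≡x′) y≡y′)
    ... | inj₂ (m≡m′ , c≡c′) = u≢w (cong₂ line (Nonzero-≡ m≡m′) c≡c′)
    no-4-cycle-of-edges pt—L   L—pt   pt—L   L—pt   u≢w v≢z = v≢z refl
    no-4-cycle-of-edges L—pt   pt—L   L—pt   pt—L   u≢w v≢z = u≢w refl
    no-4-cycle-of-edges line—P P—line line—P P—line u≢w v≢z = v≢z refl
    no-4-cycle-of-edges P—line line—P P—line line—P u≢w v≢z = u≢w refl
    no-4-cycle-of-edges pt—L L—pt (pt—line e₃) (line—pt e₄) u≢w v≢z = u≢w (cong (pt _) (trans e₄ (sym e₃)))
    no-4-cycle-of-edges L—pt (pt—line e₂) (line—pt e₃) pt—L u≢w v≢z = v≢z (cong (pt _) (trans e₂ (sym e₃)))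
    no-4-cycle-of-edges (pt—line e₁) (line—pt e₂) pt—L L—pt u≢w v≢z = u≢w (cong (pt _) (trans e₁ (sym e₂)))
    no-4-cycle-of-edges (line—pt e₁) pt—L L—pt (pt—line e₄) u≢w v≢z = v≢z (cong (pt _) (trans e₁ (sym e₄)))
    no-4-cycle-of-edges line—P P—line (line—pt e₃) (pt—line e₄) u≢w v≢z = u≢w (cong (line _) (intercept-unique e₄ e₃))
    no-4-cycle-of-edges P—line (line—pt e₂) (pt—line e₃) line—P u≢w v≢z = v≢z (cong (line _) (intercept-unique e₂ e₃))
    no-4-cycle-of-edges (line—pt e₁) (pt—line e₂) line—P P—line u≢w v≢z = u≢w (cong (line _) (intercept-unique e₁ e₂))
    no-4-cycle-of-edges (pt—line e₁) line—P P—line (line—pt e₄) u≢w v≢z = v≢z (cong (line _) (intercept-unique e₁ e₄))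

    data _⟶_ (u w : Vtx) : Set where
      arc-step  : u ⇝⟨ 1 ⟩ w → u ⟶ w
      edge-step : u — w → u ⟶ w

    step⇒⟶ : ∀ {u w} → Step H u w → u ⟶ w
    step⇒⟶ {u} {w} (inj₁ a) = arc-step (arc⇒⇝ u w a)
    step⇒⟶ {u} {w} (inj₂ e) = edge-step (edge⇒— u w e)

    step : ∀ {n} (c : Cycle H n) (i : Fin n) → Cycle.vs c i ⟶ Cycle.vs c (next i)
    step c i = step⇒⟶ (Cycle.steps c i)

    no-1-cycle : ∀ {u} → u ⟶ u → ⊥
    no-1-cycle (arc-step p)  = ⇝-irreflexive p (s≤s z≤n) (s≤s z≤n)
    no-1-cycle (edge-step e) = no-closed-walk-with-one-edge e (⇝-refl _)

    no-2-cycle : ∀ {u v} (s : Step H u v) (t : Step H v u) → (IsEdgeStep H {u} {v} s → IsEdgeStep H {v} {u} t → ⊥) → ⊥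
    no-2-cycle {u} {v} (inj₁ a) (inj₁ a′) _ = ⇝-irreflexive (arc⇒⇝ u v a ⨾ arc⇒⇝ v u a′) (s≤s z≤n) (ℕP.≤ᵇ⇒≤ _ _ _)
    no-2-cycle {u} {v} (inj₁ a) (inj₂ e) _ = no-closed-walk-with-one-edge (edge⇒— v u e) (arc⇒⇝ u v a)
    no-2-cycle {u} {v} (inj₂ e) (inj₁ a) _ = no-closed-walk-with-one-edge (edge⇒— u v e) (arc⇒⇝ v u a)
    no-2-cycle (inj₂ _) (inj₂ _) same-edge-twice = same-edge-twice tt tt

    no-3-cycle : ∀ {u v w} → u ⟶ v → v ⟶ w → w ⟶ u → ⊥
    no-3-cycle (arc-step p)   (arc-step q)   (arc-step r)   = ⇝-irreflexive (p ⨾ q ⨾ r) (s≤s z≤n) (ℕP.≤ᵇ⇒≤ _ _ _)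
    no-3-cycle (edge-step e)  (arc-step q)   (arc-step r)   = no-closed-walk-with-one-edge e (q ⨾ r)
    no-3-cycle (arc-step p)   (edge-step e)  (arc-step r)   = no-closed-walk-with-one-edge e (r ⨾ p)
    no-3-cycle (arc-step p)   (arc-step q)   (edge-step e)  = no-closed-walk-with-one-edge e (p ⨾ q)
    no-3-cycle (edge-step e₁) (edge-step e₂) (arc-step r)   =
      no-closed-walk-with-two-edges e₁ (⇝-refl _) e₂ r (s≤s z≤n) (ℕP.≤ᵇ⇒≤ _ _ _)
    no-3-cycle (arc-step p)   (edge-step e₁) (edge-step e₂) =
      no-closed-walk-with-two-edges e₁ (⇝-refl _) e₂ p (s≤s z≤n) (ℕP.≤ᵇ⇒≤ _ _ _)
    no-3-cycle (edge-step e₂) (arc-step q)   (edge-step e₁) =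
      no-closed-walk-with-two-edges e₁ (⇝-refl _) e₂ q (s≤s z≤n) (ℕP.≤ᵇ⇒≤ _ _ _)
    no-3-cycle (edge-step e₁) (edge-step e₂) (edge-step e₃) = no-closed-walk-with-three-edges e₁ e₂ e₃ (⇝-refl _)

    no-4-cycle : ∀ {u v w z} → u ⟶ v → v ⟶ w → w ⟶ z → z ⟶ u → u ≢ w → v ≢ z → ⊥
    no-4-cycle (arc-step p) (arc-step q) (arc-step r) (arc-step s) _ _ =
      ⇝-irreflexive (p ⨾ q ⨾ r ⨾ s) (s≤s z≤n) ℕP.≤-refl
    no-4-cycle (edge-step e) (arc-step q) (arc-step r) (arc-step s) _ _ = no-closed-walk-with-one-edge e (q ⨾ r ⨾ s)
    no-4-cycle (arc-step p) (edge-step e) (arc-step r) (arc-step s) _ _ = no-closed-walk-with-one-edge e (r ⨾ s ⨾ p)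
    no-4-cycle (arc-step p) (arc-step q) (edge-step e) (arc-step s) _ _ = no-closed-walk-with-one-edge e (s ⨾ p ⨾ q)
    no-4-cycle (arc-step p) (arc-step q) (arc-step r) (edge-step e) _ _ = no-closed-walk-with-one-edge e (p ⨾ q ⨾ r)
    no-4-cycle (edge-step e₁) (edge-step e₂) (arc-step r) (arc-step s) _ _ =
      no-closed-walk-with-two-edges e₁ (⇝-refl _) e₂ (r ⨾ s) (s≤s z≤n) (ℕP.≤ᵇ⇒≤ _ _ _)
    no-4-cycle (arc-step p) (edge-step e₁) (edge-step e₂) (arc-step s) _ _ =
      no-closed-walk-with-two-edges e₁ (⇝-refl _) e₂ (s ⨾ p) (s≤s z≤n) (ℕP.≤ᵇ⇒≤ _ _ _)
    no-4-cycle (arc-step p) (arc-step q) (edge-step e₁) (edge-step e₂) _ _ =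
      no-closed-walk-with-two-edges e₁ (⇝-refl _) e₂ (p ⨾ q) (s≤s z≤n) (ℕP.≤ᵇ⇒≤ _ _ _)
    no-4-cycle (edge-step e₂) (arc-step q) (arc-step r) (edge-step e₁) _ _ =
      no-closed-walk-with-two-edges e₁ (⇝-refl _) e₂ (q ⨾ r) (s≤s z≤n) (ℕP.≤ᵇ⇒≤ _ _ _)
    no-4-cycle (edge-step e₁) (arc-step q) (edge-step e₂) (arc-step s) _ _ =
      no-closed-walk-with-two-edges e₁ q e₂ s (s≤s z≤n) (ℕP.≤ᵇ⇒≤ _ _ _)
    no-4-cycle (arc-step p) (edge-step e₁) (arc-step r) (edge-step e₂) _ _ =
      no-closed-walk-with-two-edges e₁ r e₂ p (s≤s z≤n) (ℕP.≤ᵇ⇒≤ _ _ _)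
    no-4-cycle (edge-step e₁) (edge-step e₂) (edge-step e₃) (arc-step s) _ _ = no-closed-walk-with-three-edges e₁ e₂ e₃ s
    no-4-cycle (edge-step e₁) (edge-step e₂) (arc-step r) (edge-step e₄) _ _ = no-closed-walk-with-three-edges e₄ e₁ e₂ r
    no-4-cycle (edge-step e₁) (arc-step q) (edge-step e₃) (edge-step e₄) _ _ = no-closed-walk-with-three-edges e₃ e₄ e₁ q
    no-4-cycle (arc-step p) (edge-step e₂) (edge-step e₃) (edge-step e₄) _ _ = no-closed-walk-with-three-edges e₂ e₃ e₄ p
    no-4-cycle (edge-step e₁) (edge-step e₂) (edge-step e₃) (edge-step e₄) u≢w v≢z = no-4-cycle-of-edges e₁ e₂ e₃ e₄ u≢w v≢z

    girth≥5 : ∀ n → Cycle H n → 5 ≤ n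
    girth≥5 zero c with () ← Cycle.nonempty c
    girth≥5 1 c = ⊥-elim (no-1-cycle (step c (# 0)))
    girth≥5 2 c = ⊥-elim (no-2-cycle (Cycle.steps c (# 0)) (Cycle.steps c (# 1))
      (λ e₀ e₁ → Cycle.noEdgeTwice c (# 0) (# 1) (λ ()) e₀ e₁ (refl , refl)))
    girth≥5 3 c = ⊥-elim (no-3-cycle (step c (# 0)) (step c (# 1)) (step c (# 2)))
    girth≥5 4 c = ⊥-elim (no-4-cycle (step c (# 0)) (step c (# 1)) (step c (# 2)) (step c (# 3))
      (λ v₀≡v₂ → case Cycle.distinct c v₀≡v₂ of λ ()) (λ v₁≡v₃ → case Cycle.distinct c v₁≡v₃ of λ ()))
    girth≥5 (suc (suc (suc (suc (suc n))))) c = s≤s (s≤s (s≤s (s≤s (s≤s z≤n))))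

    edge-sym : ∀ u w → edge u w ≡ edge w u
    edge-sym (pt _ _)   (pt _ _)   = refl
    edge-sym (pt _ _)   (line _ _) = refl
    edge-sym (pt _ _)   (Lv _)     = refl
    edge-sym (pt _ _)   (Pv _)     = refl
    edge-sym (line _ _) (pt _ _)   = refl
    edge-sym (line _ _) (line _ _) = refl
    edge-sym (line _ _) (Lv _)     = refl
    edge-sym (line _ _) (Pv _)     = refl
    edge-sym (Lv _)     (pt _ _)   = refl
    edge-sym (Lv _)     (line _ _) = refl
    edge-sym (Lv _)     (Lv _)     = refl
    edge-sym (Lv _)     (Pv _)     = refl
    edge-sym (Pv _)     (pt _ _)   = refl
    edge-sym (Pv _)     (line _ _) = refl
    edge-sym (Pv _)     (Lv _)     = refl
    edge-sym (Pv _)     (Pv _)     = refl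

    edge-irreflexive : ∀ u → edge u u ≡ false
    edge-irreflexive (pt _ _)   = refl
    edge-irreflexive (line _ _) = refl
    edge-irreflexive (Lv _)     = refl
    edge-irreflexive (Pv _)     = refl

    arc-irreflexive : ∀ u → arc u u ≡ false
    arc-irreflexive u = ¬-not (λ a → ⇝-irreflexive (arc⇒⇝ u u a) (s≤s z≤n) (s≤s z≤n))

    edge⇒¬arc : ∀ u w → edge u w ≡ true → arc u w ≡ false
    edge⇒¬arc u w e = ¬-not (λ a → not-¬ refl (trans (⇝-side (arc⇒⇝ u w a)) (—-side (edge⇒— u w e))))

    isMixedGraph : IsMixedGraph H
    isMixedGraph = edge-sym , edge-irreflexive , arc-irreflexive , edge⇒¬arc

    coord : Vtx → Nonzero
    coord (pt x _)   = x
    coord (line m _) = m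
    coord (Lv x)     = x
    coord (Pv m)     = m

    outNeighbour inNeighbour : Vtx → ℕ → Vtx
    outNeighbour (pt x y)   e = pt (x ·ξ^ e) y
    outNeighbour (line m b) e = line (m ·ξ⁻ e) b
    outNeighbour (Lv x)     e = Lv (x ·ξ^ e)
    outNeighbour (Pv m)     e = Pv (m ·ξ⁻ e)
    inNeighbour (pt x y)   e = pt (x ·ξ⁻ e) y
    inNeighbour (line m b) e = line (m ·ξ^ e) b
    inNeighbour (Lv x)     e = Lv (x ·ξ⁻ e)
    inNeighbour (Pv m)     e = Pv (m ·ξ^ e)

    arc-outNeighbour : ∀ u {e} → 1 ≤ e → e ≤ k → arc u (outNeighbour u e) ≡ true
    arc-outNeighbour (pt x y)   {e} 1≤e e≤k = cong₂ _∧_ (∃⇒anyUpTo k _ 1≤e e≤k (≡⇒== refl)) (≡⇒== refl)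
    arc-outNeighbour (line m b) {e} 1≤e e≤k = cong₂ _∧_ (∃⇒anyUpTo k _ 1≤e e≤k (≡⇒== (*ξ⁻*ξ^ _ e))) (≡⇒== refl)
    arc-outNeighbour (Lv x)     {e} 1≤e e≤k = ∃⇒anyUpTo k _ 1≤e e≤k (≡⇒== refl)
    arc-outNeighbour (Pv m)     {e} 1≤e e≤k = ∃⇒anyUpTo k _ 1≤e e≤k (≡⇒== (*ξ⁻*ξ^ _ e))

    arc-inNeighbour : ∀ u {e} → 1 ≤ e → e ≤ k → arc (inNeighbour u e) u ≡ true
    arc-inNeighbour (pt x y)   {e} 1≤e e≤k = cong₂ _∧_ (∃⇒anyUpTo k _ 1≤e e≤k (≡⇒== (sym (*ξ⁻*ξ^ _ e)))) (≡⇒== refl)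
    arc-inNeighbour (line m b) {e} 1≤e e≤k = cong₂ _∧_ (∃⇒anyUpTo k _ 1≤e e≤k (≡⇒== refl)) (≡⇒== refl)
    arc-inNeighbour (Lv x)     {e} 1≤e e≤k = ∃⇒anyUpTo k _ 1≤e e≤k (≡⇒== (sym (*ξ⁻*ξ^ _ e)))
    arc-inNeighbour (Pv m)     {e} 1≤e e≤k = ∃⇒anyUpTo k _ 1≤e e≤k (≡⇒== refl)

    ≤1*k⇒≤k : ∀ {e} → e ≤ 1 ℕ.* k → e ≤ k
    ≤1*k⇒≤k {e} = subst (e ≤_) (ℕP.*-identityˡ k)

    ⇝⇒outNeighbour : ∀ {u w} → u ⇝⟨ 1 ⟩ w → ∃ λ e → 1 ≤ e × e ≤ k × outNeighbour u e ≡ w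
    ⇝⇒outNeighbour (points (shift e 1≤e e≤1*k x′≡xξ^e)) =
      e , 1≤e , ≤1*k⇒≤k e≤1*k , cong (λ x → pt x _) (Nonzero-≡ (sym x′≡xξ^e))
    ⇝⇒outNeighbour (lines (shift e 1≤e e≤1*k m≡m′ξ^e)) =
      e , 1≤e , ≤1*k⇒≤k e≤1*k , cong (λ m → line m _) (Nonzero-≡ (≡*ξ^⇒*ξ⁻≡ e m≡m′ξ^e))
    ⇝⇒outNeighbour (Ls (shift e 1≤e e≤1*k x′≡xξ^e)) =
      e , 1≤e , ≤1*k⇒≤k e≤1*k , cong Lv (Nonzero-≡ (sym x′≡xξ^e))
    ⇝⇒outNeighbour (Ps (shift e 1≤e e≤1*k m≡m′ξ^e)) =
      e , 1≤e , ≤1*k⇒≤k e≤1*k , cong Pv (Nonzero-≡ (≡*ξ^⇒*ξ⁻≡ e m≡m′ξ^e))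

    ⇝⇒inNeighbour : ∀ {u w} → w ⇝⟨ 1 ⟩ u → ∃ λ e → 1 ≤ e × e ≤ k × inNeighbour u e ≡ w
    ⇝⇒inNeighbour (points (shift e 1≤e e≤1*k x≡x′ξ^e)) =
      e , 1≤e , ≤1*k⇒≤k e≤1*k , cong (λ x → pt x _) (Nonzero-≡ (≡*ξ^⇒*ξ⁻≡ e x≡x′ξ^e))
    ⇝⇒inNeighbour (lines (shift e 1≤e e≤1*k m′≡mξ^e)) =
      e , 1≤e , ≤1*k⇒≤k e≤1*k , cong (λ m → line m _) (Nonzero-≡ (sym m′≡mξ^e))
    ⇝⇒inNeighbour (Ls (shift e 1≤e e≤1*k x≡x′ξ^e)) =
      e , 1≤e , ≤1*k⇒≤k e≤1*k , cong Lv (Nonzero-≡ (≡*ξ^⇒*ξ⁻≡ e x≡x′ξ^e))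
    ⇝⇒inNeighbour (Ps (shift e 1≤e e≤1*k m′≡mξ^e)) =
      e , 1≤e , ≤1*k⇒≤k e≤1*k , cong Pv (Nonzero-≡ (sym m′≡mξ^e))

    ·ξ^-injective : ∀ x {e e′} → e ≤ k → e′ ≤ k → x ·ξ^ e ≡ x ·ξ^ e′ → e ≡ e′
    ·ξ^-injective x e≤k e′≤k h =
      ξ^-injective (≤k⇒≤4k e≤k) (≤k⇒≤4k e′≤k) (*-cancelˡ (nonzero x) (cong proj₁ h))

    ·ξ⁻-injective : ∀ x {e e′} → e ≤ k → e′ ≤ k → x ·ξ⁻ e ≡ x ·ξ⁻ e′ → e ≡ e′
    ·ξ⁻-injective x {e} {e′} e≤k e′≤k h =
      ξ^-injective (≤k⇒≤4k e≤k) (≤k⇒≤4k e′≤k) (ξ⁻-injective {e} {e′} (*-cancelˡ (nonzero x) (cong proj₁ h)))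

    outNeighbour-injective : ∀ u {e e′} → e ≤ k → e′ ≤ k → outNeighbour u e ≡ outNeighbour u e′ → e ≡ e′
    outNeighbour-injective (pt x _)   e≤k e′≤k h = ·ξ^-injective x e≤k e′≤k (cong coord h)
    outNeighbour-injective (line m _) e≤k e′≤k h = ·ξ⁻-injective m e≤k e′≤k (cong coord h)
    outNeighbour-injective (Lv x)     e≤k e′≤k h = ·ξ^-injective x e≤k e′≤k (cong coord h)
    outNeighbour-injective (Pv m)     e≤k e′≤k h = ·ξ⁻-injective m e≤k e′≤k (cong coord h)

    inNeighbour-injective : ∀ u {e e′} → e ≤ k → e′ ≤ k → inNeighbour u e ≡ inNeighbour u e′ → e ≡ e′
    inNeighbour-injective (pt x _)   e≤k e′≤k h = ·ξ⁻-injective x e≤k e′≤k (cong coord h)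
    inNeighbour-injective (line m _) e≤k e′≤k h = ·ξ^-injective m e≤k e′≤k (cong coord h)
    inNeighbour-injective (Lv x)     e≤k e′≤k h = ·ξ⁻-injective x e≤k e′≤k (cong coord h)
    inNeighbour-injective (Pv m)     e≤k e′≤k h = ·ξ^-injective m e≤k e′≤k (cong coord h)

    outDegree : ∀ u → OutDegree H u k
    outDegree u = ↔-range (outNeighbour u) (outNeighbour-injective u) (arc-outNeighbour u)
      (λ w a → ⇝⇒outNeighbour (arc⇒⇝ u w a))

    inDegree : ∀ u → InDegree H u k
    inDegree u = ↔-range (inNeighbour u) (inNeighbour-injective u) (arc-inNeighbour u)
      (λ w a → ⇝⇒inNeighbour (arc⇒⇝ w u a))

    edgeNeighbours : ∀ u → Carrier ↔ Σ Vtx (λ w → edge u w ≡ true)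
    edgeNeighbours (pt x y) = ↔-trans Carrier↔MaybeNonzero (↔-subset neighbour injective incident onto)
      where
        neighbour : Maybe Nonzero → Vtx
        neighbour nothing  = Lv x
        neighbour (just m) = line m (y - proj₁ m * proj₁ x)
        injective : Injective _≡_ _≡_ neighbour
        injective {nothing} {nothing} _ = refl
        injective {just _}  {just _}  h = cong just (cong coord h)
        incident : ∀ a → edge (pt x y) (neighbour a) ≡ true
        incident nothing  = ≡⇒== refl
        incident (just m) = ≡⇒== (sym (+-minus _ y))
        onto : ∀ w → edge (pt x y) w ≡ true → ∃ λ a → neighbour a ≡ w
        onto w e with edge⇒— (pt x y) w e
        ... | pt—line {m = m} y≡mx+b = just m , cong (line m) (sym (intercept y≡mx+b))
        ... | pt—L                   = nothing , refl
    edgeNeighbours (line m b) = ↔-trans Carrier↔MaybeNonzero (↔-subset neighbour injective incident onto)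
      where
        neighbour : Maybe Nonzero → Vtx
        neighbour nothing  = Pv m
        neighbour (just x) = pt x (proj₁ m * proj₁ x + b)
        injective : Injective _≡_ _≡_ neighbour
        injective {nothing} {nothing} _ = refl
        injective {just _}  {just _}  h = cong just (cong coord h)
        incident : ∀ a → edge (line m b) (neighbour a) ≡ true
        incident nothing  = ≡⇒== refl
        incident (just x) = ≡⇒== refl
        onto : ∀ w → edge (line m b) w ≡ true → ∃ λ a → neighbour a ≡ w
        onto w e with edge⇒— (line m b) w e
        ... | line—pt {x} y≡mx+b = just x , cong (pt x) (sym y≡mx+b)
        ... | line—P             = nothing , refl
    edgeNeighbours (Lv x) = ↔-subset (pt x) (λ { refl → refl }) (λ _ → ≡⇒== refl) onto
      where
        onto : ∀ w → edge (Lv x) w ≡ true → ∃ λ y → pt x y ≡ w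
        onto w e with edge⇒— (Lv x) w e
        ... | L—pt {y = y} = y , refl
    edgeNeighbours (Pv m) = ↔-subset (line m) (λ { refl → refl }) (λ _ → ≡⇒== refl) onto
      where
        onto : ∀ w → edge (Pv m) w ≡ true → ∃ λ b → line m b ≡ w
        onto w e with edge⇒— (Pv m) w e
        ... | P—line {b = b} = b , refl

    edgeDegree : ∀ u → EdgeDegree H u q
    edgeDegree u = ↔-trans (↔-sym card) (edgeNeighbours u)

    module _ (1≤k : 1 ≤ k) where

      ξ≢1 : ξ ≢ 1#
      ξ≢1 ξ≡1 = ξ^e≢1 1 (s≤s z≤n) (≤k⇒≤4k 1≤k) (trans (*-identityʳ ξ) ξ≡1)

      one ξ̂ : Nonzero
      one = toNonzero 1# (λ 1≡0 → 0≢1 (sym 1≡0))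
      ξ̂   = toNonzero ξ ξ≢0

      pentagon : Fin 5 → Vtx
      pentagon Fin.zero                                        = Lv one
      pentagon (Fin.suc Fin.zero)                              = Lv ξ̂
      pentagon (Fin.suc (Fin.suc Fin.zero))                    = pt ξ̂ ξ
      pentagon (Fin.suc (Fin.suc (Fin.suc Fin.zero)))          = line one 0#
      pentagon (Fin.suc (Fin.suc (Fin.suc (Fin.suc Fin.zero)))) = pt one 1#

      pentagon-index : Vtx → Fin 5
      pentagon-index (pt x _)   = if proj₁ x == 1# then # 4 else # 2
      pentagon-index (line _ _) = # 3
      pentagon-index (Lv x)     = if proj₁ x == 1# then # 0 else # 1
      pentagon-index (Pv _)     = # 0

      pentagon-index-pentagon : ∀ i → pentagon-index (pentagon i) ≡ i
      pentagon-index-pentagon Fin.zero rewrite ≡⇒== {1#} refl = refl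
      pentagon-index-pentagon (Fin.suc Fin.zero) rewrite ≢⇒== ξ≢1 = refl
      pentagon-index-pentagon (Fin.suc (Fin.suc Fin.zero)) rewrite ≢⇒== ξ≢1 = refl
      pentagon-index-pentagon (Fin.suc (Fin.suc (Fin.suc Fin.zero))) = refl
      pentagon-index-pentagon (Fin.suc (Fin.suc (Fin.suc (Fin.suc Fin.zero)))) rewrite ≡⇒== {1#} refl = refl

      pentagon-injective : Injective _≡_ _≡_ pentagon
      pentagon-injective {i} {j} h = begin
        i                          ≡⟨ pentagon-index-pentagon i ⟨
        pentagon-index (pentagon i) ≡⟨ cong pentagon-index h ⟩
        pentagon-index (pentagon j) ≡⟨ pentagon-index-pentagon j ⟩
        j                          ∎
        where open ≡-Reasoning

      pentagon-step : ∀ i → Step H (pentagon i) (pentagon (next i))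
      pentagon-step Fin.zero =
        inj₁ (∃⇒anyUpTo k _ (s≤s z≤n) 1≤k (≡⇒== (sym (trans (*-identityˡ _) (*-identityʳ ξ)))))
      pentagon-step (Fin.suc Fin.zero) = inj₂ (≡⇒== refl)
      pentagon-step (Fin.suc (Fin.suc Fin.zero)) = inj₂ (≡⇒== (sym (trans (+-identityʳ _) (*-identityˡ ξ))))
      pentagon-step (Fin.suc (Fin.suc (Fin.suc Fin.zero))) = inj₂ (≡⇒== (sym (trans (+-identityʳ _) (*-identityˡ 1#))))
      pentagon-step (Fin.suc (Fin.suc (Fin.suc (Fin.suc Fin.zero)))) = inj₂ (≡⇒== refl)

      next∘next≢id : ∀ (i : Fin 5) → next (next i) ≢ i
      next∘next≢id Fin.zero ()
      next∘next≢id (Fin.suc Fin.zero) ()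
      next∘next≢id (Fin.suc (Fin.suc Fin.zero)) ()
      next∘next≢id (Fin.suc (Fin.suc (Fin.suc Fin.zero))) ()
      next∘next≢id (Fin.suc (Fin.suc (Fin.suc (Fin.suc Fin.zero)))) ()

      pentagon-cycle : Cycle H 5
      pentagon-cycle = record
        { nonempty    = s≤s z≤n
        ; vs          = pentagon
        ; distinct    = pentagon-injective
        ; steps       = pentagon-step
        ; noEdgeTwice = λ i j _ _ _ (i≈next-j , next-i≈j) →
            next∘next≢id j (trans (cong next (sym (pentagon-injective i≈next-j))) (pentagon-injective next-i≈j))
        }

      isZRGMixedGraph : IsZRGMixedGraph H k q 5
      isZRGMixedGraph = isMixedGraph , (λ u → inDegree u , outDegree u , edgeDegree u) , pentagon-cycle , girth≥5

open import Data.Nat using (_+_; _*_)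

mainTheorem2 : (q k : ℕ) → IsPrimePower q → 1 ≤ k →
    (∃ λ R → 1 ≤ R × R ≤ 5 × q ∸ 1 ≡ 4 * k + R) →
    (F : FiniteField q) → (ξ : FiniteField.Carrier F) → FiniteField.IsPrimitive F ξ →
    IsZRGMixedGraph (Construction.H F k ξ) k q 5
mainTheorem2 q k _ 1≤k (R , 1≤R , _ , q-1≡4k+R) F ξ ξ-primitive =
  HProperties.isZRGMixedGraph F k ξ (proj₁ ξ-primitive) ξ^e≢1 1≤k
  where
    ξ^e≢1 : ∀ e → 1 ≤ e → e ≤ 4 * k → FiniteField._^_ F ξ e ≢ FiniteField.1# F
    ξ^e≢1 e 1≤e e≤4k = FieldProperties.primitive-order F ξ-primitive 1≤e (begin-strict
      e          ≤⟨ e≤4k ⟩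
      4 * k      <⟨ ℕP.m<m+n (4 * k) 1≤R ⟩
      4 * k + R  ≡⟨ q-1≡4k+R ⟨
      q ∸ 1      ∎)
      where open ℕP.≤-Reasoning
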